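{- Let $s<t$ be positive integers. Then there exists a bijection $\tau:[t]\to[t]$ such that for every $a\in[t]$ with $\tau(a)\le t-s-1$, one has $\tau(a+1)=\tau(a)+s$.
   Context: For an integer $n$, $[n]=\{0,1,\ldots,n-1\}$. -}

module Defs where

-- Order [t] by residue mod s first and by quotient second, and let τ list [t] in this order.
-- Inside a residue class consecutive entries differ by s, and τ a ≤ t − s − 1 says exactly that
-- τ a + s is still in [t], hence is the entry right after τ a.  The inverse of τ, the rank of v in
-- this order, has the closed form  blockStart (v % s) + v / s; it is injective on [t], hence a
-- bijection of the finite set [t], and τ is obtained by inverting it.
module Submission where

open import Defs
open import Data.Nat using (ℕ; suc; _+_; _∸_; _≤_; _<_)
open import Data.Fin using (Fin; toℕ; fromℕ<)
open import Data.Product using (Σ; _×_; _,_)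
open import Function.Bundles using (Bijection; _⤖_)
open import Relation.Binary.PropositionalEquality using (_≡_)

open import Data.Nat.Base using (NonZero; >-nonZero; _*_; _⊓_)
open import Data.Nat.Properties
  using (module ≤-Reasoning; _<?_; <-cmp; ≤-trans; <⇒≤; <⇒≢; ≮⇒≥; 1+n≰n; m≤n⇒m≤1+n; m≤m+n; m≤n+m
        ; +-comm; +-assoc; +-suc; *-comm; +-mono-≤; +-monoˡ-≤; +-monoˡ-<; +-monoʳ-<; *-monoˡ-≤
        ; +-cancelˡ-≡; +-cancelˡ-<; *-cancelʳ-<; ⊓-monoˡ-≤; m≤n⇒m⊓n≡m; m≥n⇒m⊓n≡n
        ; m+n∸n≡m; m<n⇒0<n∸m; m≤o∸n⇒m+n≤o)
open import Data.Nat.DivMod using (_/_; _%_; m≡m%n+[m/n]*n; m%n<n; [m+n]%n≡m%n; m/n≡1+[m∸n]/n)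
open import Data.Nat.Tactic.RingSolver using (solve-∀)
open import Data.Fin using (punchOut)
open import Data.Fin.Properties using (toℕ-fromℕ<; toℕ-injective; toℕ<n; _≟_; any?; punchOut-injective; injective⇒≤)
open import Data.Product using (proj₂)
open import Function.Base using (_∘_)
open import Function.Bundles using (mk⤖)
open import Function.Construct.Symmetry using (⤖-sym)
open import Function.Consequences.Propositional using (strictlySurjective⇒surjective)
open import Function.Definitions using (Injective; StrictlySurjective)
open import Relation.Nullary using (yes; no; contradiction)
open import Relation.Binary.Definitions using (tri<; tri≈; tri>)
open import Relation.Binary.PropositionalEquality using (_≢_; refl; sym; trans; cong; cong₂; subst; module ≡-Reasoning)

injective⇒strictlySurjective : ∀ {n} {f : Fin n → Fin n} →
  Injective _≡_ _≡_ f → StrictlySurjective _≡_ f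
injective⇒strictlySurjective {suc n} {f} f-inj y with any? (λ x → f x ≟ y)
... | yes hit  = hit
... | no  miss = contradiction (injective⇒≤ punched-injective) 1+n≰n
  where
  y≢f : ∀ x → y ≢ f x
  y≢f x y≡fx = miss (x , sym y≡fx)
  punched-injective : Injective _≡_ _≡_ (λ x → punchOut (y≢f x))
  punched-injective e = f-inj (punchOut-injective (y≢f _) (y≢f _) e)

module ResidueMajorRank (s t : ℕ) .{{_ : NonZero s}} where

  n m : ℕ
  n = t / s
  m = t % s

  -- Number of v < t with v % s < r: the residues below m occur n + 1 times, the others n times.
  blockStart : ℕ → ℕ
  blockStart r = r * n + r ⊓ m

  rank : ℕ → ℕ
  rank v = blockStart (v % s) + v / s

  t≡m+n*s : t ≡ m + n * s
  t≡m+n*s = m≡m%n+[m/n]*n t s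

  blockStart-mono : ∀ {r r′} → r ≤ r′ → blockStart r ≤ blockStart r′
  blockStart-mono r≤r′ = +-mono-≤ (*-monoˡ-≤ n r≤r′) (⊓-monoˡ-≤ m r≤r′)

  blockStart-s≡t : blockStart s ≡ t
  blockStart-s≡t = begin
    s * n + s ⊓ m ≡⟨ cong₂ _+_ (*-comm s n) (m≥n⇒m⊓n≡n (<⇒≤ (m%n<n t s))) ⟩
    n * s + m     ≡⟨ +-comm (n * s) m ⟩
    m + n * s     ≡⟨ sym t≡m+n*s ⟩
    t             ∎
    where open ≡-Reasoning

  quotient<1+n : ∀ r q → r + q * s < t → q < suc n
  quotient<1+n r q r+qs<t = *-cancelʳ-< s q (suc n) (begin-strict
    q * s     ≤⟨ m≤n+m (q * s) r ⟩
    r + q * s <⟨ r+qs<t ⟩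
    t         ≡⟨ t≡m+n*s ⟩
    m + n * s <⟨ +-monoˡ-< (n * s) (m%n<n t s) ⟩
    s + n * s ∎)
    where open ≤-Reasoning

  quotient<n : ∀ r q → m ≤ r → r + q * s < t → q < n
  quotient<n r q m≤r r+qs<t = *-cancelʳ-< s q n (+-cancelˡ-< r (q * s) (n * s) (begin-strict
    r + q * s <⟨ r+qs<t ⟩
    t         ≡⟨ t≡m+n*s ⟩
    m + n * s ≤⟨ +-monoˡ-≤ (n * s) m≤r ⟩
    r + n * s ∎))
    where open ≤-Reasoning

  blockStart-+-< : ∀ r q → r + q * s < t → blockStart r + q < blockStart (suc r)
  blockStart-+-< r q r+qs<t with r <? m
  ... | yes r<m = begin-strict
    r * n + r ⊓ m + q       ≡⟨ cong (λ x → r * n + x + q) (m≤n⇒m⊓n≡m (<⇒≤ r<m)) ⟩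
    r * n + r + q           <⟨ +-monoʳ-< (r * n + r) (quotient<1+n r q r+qs<t) ⟩
    r * n + r + suc n       ≡⟨ rearrange r n ⟩
    suc r * n + suc r       ≡⟨ cong (suc r * n +_) (sym (m≤n⇒m⊓n≡m r<m)) ⟩
    suc r * n + suc r ⊓ m   ∎
    where
    open ≤-Reasoning
    rearrange : ∀ r n → r * n + r + suc n ≡ suc r * n + suc r
    rearrange = solve-∀
  ... | no r≮m = begin-strict
    r * n + r ⊓ m + q       ≡⟨ cong (λ x → r * n + x + q) (m≥n⇒m⊓n≡n m≤r) ⟩
    r * n + m + q           <⟨ +-monoʳ-< (r * n + m) (quotient<n r q m≤r r+qs<t) ⟩
    r * n + m + n           ≡⟨ rearrange r n m ⟩
    suc r * n + m           ≡⟨ cong (suc r * n +_) (sym (m≥n⇒m⊓n≡n (m≤n⇒m≤1+n m≤r))) ⟩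
    suc r * n + suc r ⊓ m   ∎
    where
    open ≤-Reasoning
    m≤r : m ≤ r
    m≤r = ≮⇒≥ r≮m
    rearrange : ∀ r n m → r * n + m + n ≡ suc r * n + m
    rearrange = solve-∀

  v≡v%s+v/s*s : ∀ v → v ≡ v % s + v / s * s
  v≡v%s+v/s*s v = m≡m%n+[m/n]*n v s

  rank<blockStart-suc : ∀ {v} → v < t → rank v < blockStart (suc (v % s))
  rank<blockStart-suc {v} v<t =
    blockStart-+-< (v % s) (v / s) (subst (_< t) (v≡v%s+v/s*s v) v<t)

  rank<t : ∀ {v} → v < t → rank v < t
  rank<t {v} v<t = subst (rank v <_) blockStart-s≡t
    (≤-trans (rank<blockStart-suc v<t) (blockStart-mono (m%n<n v s)))

  residue<⇒rank< : ∀ {v w} → v < t → v % s < w % s → rank v < rank w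
  residue<⇒rank< {v} {w} v<t lt = ≤-trans (rank<blockStart-suc v<t)
    (≤-trans (blockStart-mono lt) (m≤m+n (blockStart (w % s)) (w / s)))

  rank-injective : ∀ {v w} → v < t → w < t → rank v ≡ rank w → v ≡ w
  rank-injective {v} {w} v<t w<t eq with <-cmp (v % s) (w % s)
  ... | tri< v%s<w%s _ _ = contradiction eq (<⇒≢ (residue<⇒rank< v<t v%s<w%s))
  ... | tri> _ _ w%s<v%s = contradiction (sym eq) (<⇒≢ (residue<⇒rank< w<t w%s<v%s))
  ... | tri≈ _ v%s≡w%s _ = begin
    v                 ≡⟨ v≡v%s+v/s*s v ⟩
    v % s + v / s * s ≡⟨ cong₂ (λ r q → r + q * s) v%s≡w%s v/s≡w/s ⟩
    w % s + w / s * s ≡⟨ sym (v≡v%s+v/s*s w) ⟩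
    w                 ∎
    where
    open ≡-Reasoning
    v/s≡w/s : v / s ≡ w / s
    v/s≡w/s = +-cancelˡ-≡ (blockStart (v % s)) (v / s) (w / s)
      (trans eq (cong (λ r → blockStart r + w / s) (sym v%s≡w%s)))

  rank-+s : ∀ v → rank (v + s) ≡ suc (rank v)
  rank-+s v = begin
    blockStart ((v + s) % s) + (v + s) / s ≡⟨ cong₂ (λ r q → blockStart r + q) ([m+n]%n≡m%n v s) [v+s]/s≡1+v/s ⟩
    blockStart (v % s) + suc (v / s)       ≡⟨ +-suc (blockStart (v % s)) (v / s) ⟩
    suc (rank v)                           ∎
    where
    open ≡-Reasoning
    [v+s]/s≡1+v/s : (v + s) / s ≡ suc (v / s)
    [v+s]/s≡1+v/s = trans (m/n≡1+[m∸n]/n (m≤n+m s v)) (cong (λ x → suc (x / s)) (m+n∸n≡m v s))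

  rankᶠ : Fin t → Fin t
  rankᶠ x = fromℕ< (rank<t (toℕ<n x))

  toℕ-rankᶠ : ∀ x → toℕ (rankᶠ x) ≡ rank (toℕ x)
  toℕ-rankᶠ x = toℕ-fromℕ< (rank<t (toℕ<n x))

  rankᶠ-injective : Injective _≡_ _≡_ rankᶠ
  rankᶠ-injective {x} {y} eq = toℕ-injective (rank-injective (toℕ<n x) (toℕ<n y) (begin
    rank (toℕ x)    ≡⟨ sym (toℕ-rankᶠ x) ⟩
    toℕ (rankᶠ x)   ≡⟨ cong toℕ eq ⟩
    toℕ (rankᶠ y)   ≡⟨ toℕ-rankᶠ y ⟩
    rank (toℕ y)    ∎))
    where open ≡-Reasoning

  rank-bijection : Fin t ⤖ Fin t
  rank-bijection = mk⤖ (rankᶠ-injective ,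
    strictlySurjective⇒surjective (injective⇒strictlySurjective rankᶠ-injective))

  rankᶠ-+s : ∀ x y → toℕ y ≡ toℕ x + s → toℕ (rankᶠ y) ≡ suc (toℕ (rankᶠ x))
  rankᶠ-+s x y y≡x+s = begin
    toℕ (rankᶠ y)        ≡⟨ toℕ-rankᶠ y ⟩
    rank (toℕ y)         ≡⟨ cong rank y≡x+s ⟩
    rank (toℕ x + s)     ≡⟨ rank-+s (toℕ x) ⟩
    suc (rank (toℕ x))   ≡⟨ cong suc (sym (toℕ-rankᶠ x)) ⟩
    suc (toℕ (rankᶠ x))  ∎
    where open ≡-Reasoning

inverse-of-+s-to-suc : ∀ {t} s (σ : Fin t ⤖ Fin t) →
  (∀ x y → toℕ y ≡ toℕ x + s → toℕ (Bijection.to σ y) ≡ suc (toℕ (Bijection.to σ x))) →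
  ∀ a → toℕ (Bijection.to (⤖-sym σ) a) + s < t →
  Σ (suc (toℕ a) < t) λ h →
    toℕ (Bijection.to (⤖-sym σ) (fromℕ< h)) ≡ toℕ (Bijection.to (⤖-sym σ) a) + s
inverse-of-+s-to-suc {t} s σ σ-+s a τa+s<t = 1+a<t , τ[1+a]≡τa+s
  where
  open Bijection σ using (to; injective; surjective)
  open ≡-Reasoning
  τ : Fin t → Fin t
  τ = Bijection.to (⤖-sym σ)
  σ∘τ : ∀ y → to (τ y) ≡ y
  σ∘τ y = proj₂ (surjective y) refl
  τ∘σ : ∀ x → τ (to x) ≡ x
  τ∘σ x = injective (σ∘τ (to x))
  b : Fin t
  b = fromℕ< τa+s<t
  σb≡1+a : toℕ (to b) ≡ suc (toℕ a)
  σb≡1+a = trans (σ-+s (τ a) b (toℕ-fromℕ< τa+s<t)) (cong (suc ∘ toℕ) (σ∘τ a))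
  1+a<t : suc (toℕ a) < t
  1+a<t = subst (_< t) σb≡1+a (toℕ<n (to b))
  τ[1+a]≡τa+s : toℕ (τ (fromℕ< 1+a<t)) ≡ toℕ (τ a) + s
  τ[1+a]≡τa+s = begin
    toℕ (τ (fromℕ< 1+a<t)) ≡⟨ cong (toℕ ∘ τ) (toℕ-injective (trans (toℕ-fromℕ< 1+a<t) (sym σb≡1+a))) ⟩
    toℕ (τ (to b))         ≡⟨ cong toℕ (τ∘σ b) ⟩
    toℕ b                  ≡⟨ toℕ-fromℕ< τa+s<t ⟩
    toℕ (τ a) + s          ∎

≤∸∸1⇒+< : ∀ {v s t} → s < t → v ≤ t ∸ s ∸ 1 → v + s < t
≤∸∸1⇒+< {v} {s} {t} s<t v≤ = subst (_≤ t) (trans (+-assoc v 1 s) (+-suc v s))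
  (m≤o∸n⇒m+n≤o (v + 1) (<⇒≤ s<t) (m≤o∸n⇒m+n≤o v (m<n⇒0<n∸m s<t) v≤))

corollary2p4 : (s t : ℕ) → 1 ≤ s → s < t →
    Σ (Fin t ⤖ Fin t) λ τ →
      (a : Fin t) → toℕ (Bijection.to τ a) ≤ t ∸ s ∸ 1 →
        Σ (suc (toℕ a) < t) λ h →
          toℕ (Bijection.to τ (fromℕ< h)) ≡ toℕ (Bijection.to τ a) + s
corollary2p4 s t 1≤s s<t = ⤖-sym rank-bijection , λ a τa≤ →
  inverse-of-+s-to-suc s rank-bijection rankᶠ-+s a (≤∸∸1⇒+< s<t τa≤)
  where open ResidueMajorRank s t {{>-nonZero 1≤s}}
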